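{- Suppose that during the decomposition algorithm a refined segment $[b_c,j]$ is appended to the tail of $\mathrm{RS}[c]$ while processing column $j$, let $c'=\phi_j(c)\ge 1$, and suppose that at that moment $[b_c,j]$ overlaps $d$ refined segments in $\mathrm{RS}[c']$. Then the right endpoint of the last refined segment stored in $\mathrm{RS}[c']$ at that moment is $j$.
   Context: Setting: haplotypes $S_1,\dots,S_h$ of length $m$; prefix array $\mathrm{PA}$ ($h\times m$, column $1$ is $1,\dots,h$, column $j>1$ sorts indices by co-lexicographic order of $S_i[1..j-1]$, ties broken stably); PBWT with $\mathrm{col}_j(\mathrm{PBWT})[x]=S_{\mathrm{col}_j(\mathrm{PA})[x]}[j]$; $(x,j)$ is a run-top if $x=1$ or $\mathrm{col}_j(\mathrm{PBWT})[x]\ne\mathrm{col}_j(\mathrm{PBWT})[x-1]$. For $\mathrm{col}_j(\mathrm{PA})[x]=i$: $\phi_j(i)=0$ if $x=1$, else $\phi_j(i)=\mathrm{col}_j(\mathrm{PA})[x-1]$. Haplotype intervals of $S_i$: with $b_1<\dots<b_k=m$ the set of $m$ and all columns $j$ such that some run-top $(x,j)$ has $\mathrm{col}_j(\mathrm{PA})[x]=i$, they are $[1,b_1],[b_1+1,b_2],\dots,[b_{k-1}+1,b_k]$. Two intervals overlap if they share an integer. Decomposition algorithm with integer parameter $d>1$: initially, for each $c$, $L_c$ is the linked list of haplotype intervals of $S_c$ in increasing order and $\mathrm{RS}[c]$ is empty. For $j=1,\dots,m$ and, within each $j$, for $i=1,\dots,h$: let $c=\mathrm{col}_j(\mathrm{PA})[i]$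 and let $[b_c,e_c]$ be the first interval of $L_c$. If $j=e_c$, remove $[b_c,e_c]$ from $L_c$ and append it to the tail of $\mathrm{RS}[c]$ (Passive Split). Otherwise, if $i>1$ and $[b_c,j]$ overlaps exactly $d$ refined segments currently in $\mathrm{RS}[c']$, where $c'=\mathrm{col}_j(\mathrm{PA})[i-1]$, append $[b_c,j]$ to $\mathrm{RS}[c]$ and replace the head $[b_c,e_c]$ of $L_c$ by $[j+1,e_c]$ (Active Split). Intervals in the lists $\mathrm{RS}[\cdot]$ are called refined segments. -}

module Defs where

open import Data.Nat.Base using (ℕ; zero; suc; _∸_; _⊔_; _⊓_; _≡ᵇ_; _<ᵇ_; _≤ᵇ_)
open import Data.Bool.Base using (Bool; true; false; _∧_; _∨_; not; if_then_else_)
open import Data.List.Base using (List; []; _∷_; _++_; map; reverse; filter; foldl; foldr; applyUpTo; length)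
open import Data.Bool.ListAction using (any)
open import Data.Product.Base using (_×_; _,_)
open import Relation.Nullary.Decidable.Core using (T?)

-- Haplotypes S_1..S_h of length m are modelled as a function
-- S : ℕ → ℕ → ℕ, where  S i j  is the character S_i[j] (1-based
-- indices, 1 ≤ i ≤ h, 1 ≤ j ≤ m; other values are never used).
Haps : Set
Haps = ℕ → ℕ → ℕ

upTo1 : ℕ → List ℕ
upTo1 n = applyUpTo suc n

-- 1-based lookup (0 when out of range)
at : List ℕ → ℕ → ℕ
at []       _             = 0
at (x ∷ xs) zero          = 0
at (x ∷ xs) (suc zero)    = x
at (x ∷ xs) (suc (suc n)) = at xs (suc n)

-- 1-based position of an element (0 when absent)
posOf : ℕ → List ℕ → ℕ
posOf i []       = 0
posOf i (x ∷ xs) = if i ≡ᵇ x then 1 else (if posOf i xs ≡ᵇ 0 then 0 else suc (posOf i xs))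

lexLt : List ℕ → List ℕ → Bool
lexLt []       []       = false
lexLt []       (_ ∷ _)  = true
lexLt (_ ∷ _)  []       = false
lexLt (x ∷ xs) (y ∷ ys) = (x <ᵇ y) ∨ ((x ≡ᵇ y) ∧ lexLt xs ys)

colexLt : List ℕ → List ℕ → Bool
colexLt u v = lexLt (reverse u) (reverse v)

prefixStr : Haps → ℕ → ℕ → List ℕ
prefixStr S i j = map (S i) (upTo1 (j ∸ 1))

-- index a comes before index b in column j of PA:
-- co-lex order of S_a[1..j-1] vs S_b[1..j-1], ties broken stably (by index)
precedes : Haps → ℕ → ℕ → ℕ → Bool
precedes S j a b =
  colexLt (prefixStr S a j) (prefixStr S b j)
  ∨ (not (colexLt (prefixStr S a j) (prefixStr S b j))
     ∧ not (colexLt (prefixStr S b j) (prefixStr S a j))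
     ∧ (a ≤ᵇ b))

insertBy : (ℕ → ℕ → Bool) → ℕ → List ℕ → List ℕ
insertBy p x []       = x ∷ []
insertBy p x (y ∷ ys) = if p x y then x ∷ y ∷ ys else y ∷ insertBy p x ys

sortBy : (ℕ → ℕ → Bool) → List ℕ → List ℕ
sortBy p = foldr (insertBy p) []

-- col_j(PA) as a list of length h (entry x is col_j(PA)[x]);
-- for j = 1 all prefixes are empty, so this is 1,...,h
colPA : Haps → ℕ → ℕ → List ℕ
colPA S h j = sortBy (precedes S j) (upTo1 h)

pbwt : Haps → ℕ → ℕ → ℕ → ℕ
pbwt S h j x = S (at (colPA S h j) x) j

isRunTop : Haps → ℕ → ℕ → ℕ → Bool
isRunTop S h x j = (x ≡ᵇ 1) ∨ not (pbwt S h j x ≡ᵇ pbwt S h j (x ∸ 1))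

φ : Haps → ℕ → ℕ → ℕ → ℕ
φ S h j i = let x = posOf i (colPA S h j) in
  if x ≤ᵇ 1 then 0 else at (colPA S h j) (x ∸ 1)

-- j is one of the b's of S_i: j = m, or some run-top (x , j) has col_j(PA)[x] = i
isBreak : Haps → ℕ → ℕ → ℕ → ℕ → Bool
isBreak S h m i j =
  (j ≡ᵇ m) ∨ any (λ x → isRunTop S h x j ∧ (at (colPA S h j) x ≡ᵇ i)) (upTo1 h)

breaks : Haps → ℕ → ℕ → ℕ → List ℕ
breaks S h m i = filter (λ j → T? (isBreak S h m i j)) (upTo1 m)

Interval : Set
Interval = ℕ × ℕ

mkIntervals : ℕ → List ℕ → List Interval
mkIntervals s []       = []
mkIntervals s (e ∷ es) = (s , e) ∷ mkIntervals (suc e) es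

hapIntervals : Haps → ℕ → ℕ → ℕ → List Interval
hapIntervals S h m i = mkIntervals 1 (breaks S h m i)

overlaps : Interval → Interval → Bool
overlaps (a , e) (b , f) = (a ⊔ b) ≤ᵇ (e ⊓ f)

overlapCount : Interval → List Interval → ℕ
overlapCount I xs = length (filter (λ J → T? (overlaps I J)) xs)

record State : Set where
  constructor st
  field
    L  : ℕ → List Interval
    RS : ℕ → List Interval
open State public

update : {A : Set} → (ℕ → A) → ℕ → A → ℕ → A
update f c v c″ = if c″ ≡ᵇ c then v else f c″

initState : Haps → ℕ → ℕ → State
initState S h m = st (hapIntervals S h m) (λ _ → [])

step : Haps → ℕ → ℕ → ℕ → ℕ → ℕ → State → State
step S h m d j i s with L s (at (colPA S h j) i)
... | [] = s
... | (b , e) ∷ rest =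
  let c  = at (colPA S h j) i
      c′ = at (colPA S h j) (i ∸ 1)
  in if j ≡ᵇ e
     then st (update (L s) c rest) (update (RS s) c (RS s c ++ ((b , e) ∷ [])))
     else (if (1 <ᵇ i) ∧ (overlapCount (b , j) (RS s c′) ≡ᵇ d)
           then st (update (L s) c ((suc j , e) ∷ rest))
                   (update (RS s) c (RS s c ++ ((b , j) ∷ [])))
           else s)

runRows : Haps → ℕ → ℕ → ℕ → ℕ → ℕ → State → State
runRows S h m d j k s = foldl (λ s′ i → step S h m d j i s′) s (upTo1 k)

runCols : Haps → ℕ → ℕ → ℕ → ℕ → State → State
runCols S h m d k s = foldl (λ s′ j → runRows S h m d j h s′) s (upTo1 k)

stateBefore : Haps → ℕ → ℕ → ℕ → ℕ → ℕ → State
stateBefore S h m d j i =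
  runRows S h m d j (i ∸ 1) (runCols S h m d (j ∸ 1) (initState S h m))

-- Let c′ = φ_j(c) be the haplotype directly above c in col_j(PA).  If c′ was split
-- (passively or actively) when its row of column j was processed, the segment it received ends
-- at j.  Otherwise RS[c′] is still as it was after column j − 1, so all its segments end before
-- j, and overlapping [b, j] (d ≥ 1 is all that is used) forces b ≤ j − 1.  Then the head [b, e]
-- of L_c survived column j − 1 unsplit: j − 1 is not a break of c, so c's row of column j − 1 is
-- not a run-top and c shares the character S[j − 1] with its predecessor w there; and the active
-- split of c at j − 1 was refused, so [b, j − 1] does not overlap d segments of RS[w].  Sharing
-- that character keeps w directly above c in col_j(PA), hence w = c′; but segments ending before
-- j meet [b, j − 1] exactly when they meet [b, j], a contradiction.
module Submission where

open import Defs
open import Level using (0ℓ)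
open import Data.Bool.Base using (Bool; true; false; T; not; _∧_; _∨_)
open import Data.Bool.Properties using (T-∨; T-∧; T-≡)
open import Data.Empty using (⊥; ⊥-elim)
open import Data.List.Base using (List; []; _∷_; _++_; length; map; reverse; applyUpTo; foldl)
open import Data.List.Properties
  using ( applyUpTo-∷ʳ; foldl-∷ʳ; map-++; reverse-++; length-applyUpTo; filter-none
        ; ∷ʳ-injective; ++-cancelˡ; ++-identityʳ)
open import Data.List.Membership.Propositional using (_∈_; lose)
open import Data.List.Membership.Propositional.Properties using (∈-applyUpTo⁺; ∈-filter⁺)
open import Data.List.Relation.Binary.Lex.Strict using (Lex-<; halt; this; next)
import Data.List.Relation.Binary.Lex.Strict as Lex
open import Data.List.Relation.Binary.Pointwise using (Pointwise; _∷_)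
open import Data.List.Relation.Binary.Permutation.Propositional using (_↭_; ↭-sym; ↭-trans; ↭⇒↭ₛ)
open import Data.List.Relation.Binary.Permutation.Propositional.Properties using (∈-resp-↭; ↭-length)
import Data.List.Relation.Binary.Permutation.Setoid.Properties as Permutationₛ
open import Data.List.Relation.Unary.All as All using (All; []; _∷_)
import Data.List.Relation.Unary.All.Properties as All
open import Data.List.Relation.Unary.AllPairs as AllPairs using (AllPairs; []; _∷_)
import Data.List.Relation.Unary.AllPairs.Properties as AllPairs
open import Data.List.Relation.Unary.Any using (here; there)
open import Data.List.Relation.Unary.Any.Properties using (any⁺)
open import Data.List.Relation.Unary.Sorted.TotalOrder.Properties using (Sorted⇒AllPairs)
open import Data.List.Relation.Unary.Unique.Propositional using (Unique)
import Data.List.Relation.Unary.Unique.Propositional.Properties as Unique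
import Data.List.Sort.InsertionSort.Base as InsertionSort
import Data.List.Sort.InsertionSort.Properties as InsertionSortₚ
open import Data.Nat.Base
open import Data.Nat.Properties
open import Data.Product.Base using (_×_; _,_; proj₁; proj₂; ∃-syntax; ∃₂)
open import Data.Product.Relation.Binary.Lex.Strict using (×-Lex; ×-transitive; ×-antisymmetric; ×-total₂)
open import Data.Product.Relation.Binary.Pointwise.NonDependent using () renaming (Pointwise to ×-Pointwise)
open import Data.Sum.Base using (_⊎_; inj₁; inj₂)
import Data.Sum.Base as Sum
open import Function.Base using (_∘_; _$_)
open import Function.Bundles using (_⇔_; mk⇔; Equivalence)
open import Function.Construct.Composition using (_⇔-∘_)
open import Function.Construct.Identity using (⇔-id)
open import Function.Construct.Symmetry using (⇔-sym)
open import Relation.Binary.Bundles using (DecTotalOrder)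
open import Relation.Binary.Core using (Rel)
open import Relation.Binary.Definitions using (Asymmetric; Antisymmetric; Transitive; Total; tri<; tri≈; tri>)
open import Relation.Binary.PropositionalEquality
  using (_≡_; _≢_; refl; sym; trans; cong; subst; ≢-sym; module ≡-Reasoning)
import Relation.Binary.PropositionalEquality as ≡
open import Relation.Binary.Structures using (IsEquivalence; IsStrictTotalOrder)
open import Relation.Nullary.Decidable.Core using (yes; no; T?)
open import Relation.Nullary.Negation using (¬_; contradiction)

open Equivalence using (to; from)

¬T⇒T-not : ∀ {x} → ¬ T x → T (not x)
¬T⇒T-not {false} _  = _
¬T⇒T-not {true}  ¬t = ¬t _

T-not⇒¬T : ∀ {x} → T (not x) → ¬ T x
T-not⇒¬T {false} _ ()

¬T-not⇒T : ∀ {x} → ¬ T (not x) → T x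
¬T-not⇒T {false} ¬t = ¬t _
¬T-not⇒T {true}  _  = _

≡false⇒¬T : ∀ {x} → x ≡ false → ¬ T x
≡false⇒¬T refl ()

≡ᵇ-refl : ∀ n → (n ≡ᵇ n) ≡ true
≡ᵇ-refl n = to T-≡ (≡⇒≡ᵇ n n refl)

≢⇒≡ᵇ-false : ∀ {m n} → m ≢ n → (m ≡ᵇ n) ≡ false
≢⇒≡ᵇ-false {m} {n} m≢n with m ≡ᵇ n in eq
... | false = refl
... | true  = contradiction (≡ᵇ⇒≡ m n (from T-≡ eq)) m≢n

≡ᵇ-false⇒≢ : ∀ {m n} → (m ≡ᵇ n) ≡ false → m ≢ n
≡ᵇ-false⇒≢ {m} eq refl with () ← trans (sym (≡ᵇ-refl m)) eq

≢-∷ʳ : ∀ {A : Set} (xs : List A) y → xs ≢ xs ++ y ∷ []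
≢-∷ʳ xs y eq with () ← ++-cancelˡ xs [] (y ∷ []) (trans (++-identityʳ xs) eq)

at-zero : ∀ xs → at xs 0 ≡ 0
at-zero []      = refl
at-zero (_ ∷ _) = refl

at-∈ : ∀ xs {r} → r < length xs → at xs (suc r) ∈ xs
at-∈ (x ∷ xs) {zero}  _         = here refl
at-∈ (x ∷ xs) {suc r} (s<s r<n) = there (at-∈ xs r<n)

∈⇒at : ∀ {x xs} → x ∈ xs → ∃[ r ] r < length xs × at xs (suc r) ≡ x
∈⇒at (here refl) = zero , z<s , refl
∈⇒at (there x∈xs) with r , r<n , eq ← ∈⇒at x∈xs = suc r , s<s r<n , eq

AllPairs-at : ∀ {ℓ} {R : Rel ℕ ℓ} {xs r r′} → AllPairs R xs → r < r′ → r′ < length xs →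
  R (at xs (suc r)) (at xs (suc r′))
AllPairs-at {xs = _ ∷ xs} {zero}  {suc r′} (Rx ∷ _)  _          (s<s r′<n) = All.lookup Rx (at-∈ xs r′<n)
AllPairs-at {xs = _ ∷ _}  {suc r} {suc r′} (_ ∷ Rxs) (s<s r<r′) (s<s r′<n) = AllPairs-at Rxs r<r′ r′<n

at-injective : ∀ {xs r r′} → Unique xs → r < length xs → r′ < length xs →
  at xs (suc r) ≡ at xs (suc r′) → r ≡ r′
at-injective {r = r} {r′} unique r<n r′<n eq with <-cmp r r′
... | tri< r<r′ _ _ = contradiction eq (AllPairs-at unique r<r′ r′<n)
... | tri≈ _ r≡r′ _ = r≡r′
... | tri> _ _ r′<r = contradiction (sym eq) (AllPairs-at unique r′<r r<n)

posOf-at : ∀ {xs r} → Unique xs → r < length xs → posOf (at xs (suc r)) xs ≡ suc r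
posOf-at {x ∷ xs} {zero}  _                _         rewrite ≡ᵇ-refl x = refl
posOf-at {x ∷ xs} {suc r} (x∉xs ∷ unique) (s<s r<n)
  rewrite ≢⇒≡ᵇ-false (≢-sym (All.lookup x∉xs (at-∈ xs r<n))) | posOf-at unique r<n = refl

Adjacent : List ℕ → ℕ → ℕ → Set
Adjacent xs w c = ∃[ r ] suc r < length xs × at xs (suc r) ≡ w × at xs (suc (suc r)) ≡ c

Adjacent⇒∈ˡ : ∀ {xs w c} → Adjacent xs w c → w ∈ xs
Adjacent⇒∈ˡ {xs} (r , r<n , refl , _) = at-∈ xs (<-trans (n<1+n r) r<n)

Adjacent⇒∈ʳ : ∀ {xs w c} → Adjacent xs w c → c ∈ xs
Adjacent⇒∈ʳ {xs} (r , r<n , _ , refl) = at-∈ xs r<n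

Adjacent⇒above : ∀ {xs w p} → Unique xs → suc p < length xs →
  Adjacent xs w (at xs (suc (suc p))) → w ≡ at xs (suc p)
Adjacent⇒above unique p<n (r , r<n , refl , eq) with refl ← at-injective unique r<n p<n eq = refl

module _ {ℓ} {_⊏_ : Rel ℕ ℓ} (⊏-asym : Asymmetric _⊏_) {xs : List ℕ} (sorted : AllPairs _⊏_ xs) where

  private
    ⊏-irrefl : ∀ {x} → ¬ x ⊏ x
    ⊏-irrefl x⊏x = ⊏-asym x⊏x x⊏x

  Adjacent⇒⊏ : ∀ {w c} → Adjacent xs w c → w ⊏ c
  Adjacent⇒⊏ (r , r<n , refl , refl) = AllPairs-at sorted (n<1+n r) r<n

  Adjacent⇒nothing-between : ∀ {w c z} → Adjacent xs w c → z ∈ xs → w ⊏ z → z ⊏ c → ⊥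
  Adjacent⇒nothing-between (r , r<n , refl , refl) z∈xs w⊏z z⊏c with q , q<n , refl ← ∈⇒at z∈xs
    with <-cmp q r
  ... | tri< q<r _ _ = ⊏-asym w⊏z (AllPairs-at sorted q<r (<-trans (n<1+n r) r<n))
  ... | tri≈ _ refl _ = ⊏-irrefl w⊏z
  ... | tri> _ _ r<q with m≤n⇒m<n∨m≡n r<q
  ...   | inj₁ 1+r<q = ⊏-asym z⊏c (AllPairs-at sorted 1+r<q q<n)
  ...   | inj₂ refl  = ⊏-irrefl z⊏c

  nothing-between⇒Adjacent : ∀ {w c} → w ∈ xs → c ∈ xs → w ⊏ c →
    (∀ {z} → z ∈ xs → w ⊏ z → z ⊏ c → ⊥) → Adjacent xs w c
  nothing-between⇒Adjacent w∈xs c∈xs w⊏c between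
    with p , p<n , refl ← ∈⇒at w∈xs | q , q<n , refl ← ∈⇒at c∈xs
    with <-cmp p q
  ... | tri≈ _ refl _ = contradiction w⊏c ⊏-irrefl
  ... | tri> _ _ q<p  = contradiction (AllPairs-at sorted q<p p<n) (⊏-asym w⊏c)
  ... | tri< p<q _ _ with m≤n⇒m<n∨m≡n p<q
  ...   | inj₂ refl  = p , q<n , refl , refl
  ...   | inj₁ 1+p<q = contradiction (AllPairs-at sorted 1+p<q q<n)
                         (between (at-∈ xs 1+p<n) (AllPairs-at sorted (n<1+n p) 1+p<n))
    where
    1+p<n : suc p < length xs
    1+p<n = <-trans 1+p<q q<n

-- The order sorting col_j(PA)

_≺_ : Rel (List ℕ) 0ℓ
_≺_ = Lex-< _≡_ _<_

_≋_ : Rel (List ℕ) 0ℓ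
_≋_ = Pointwise _≡_

≺-isStrictTotalOrder : IsStrictTotalOrder _≋_ _≺_
≺-isStrictTotalOrder = Lex.<-isStrictTotalOrder <-isStrictTotalOrder

open IsStrictTotalOrder ≺-isStrictTotalOrder
  using (<-resp-≈)
  renaming ( isEquivalence to ≋-isEquivalence; irrefl to ≺-irrefl; asym to ≺-asym
           ; trans to ≺-trans; compare to ≺-compare)
module ≋ = IsEquivalence ≋-isEquivalence

lexLt⇒≺ : ∀ u v → T (lexLt u v) → u ≺ v
lexLt⇒≺ []      (_ ∷ _) _ = halt
lexLt⇒≺ (x ∷ u) (y ∷ v) lt with to T-∨ lt
... | inj₁ x<y = this (<ᵇ⇒< x y x<y)
... | inj₂ x≡y∧u<v with x≡y , u<v ← to T-∧ x≡y∧u<v = next (≡ᵇ⇒≡ x y x≡y) (lexLt⇒≺ u v u<v)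

≺⇒lexLt : ∀ {u v} → u ≺ v → T (lexLt u v)
≺⇒lexLt halt                     = _
≺⇒lexLt (this x<y)               = from T-∨ (inj₁ (<⇒<ᵇ x<y))
≺⇒lexLt {x ∷ _} (next refl u≺v) = from T-∨ (inj₂ (from T-∧ (≡⇒≡ᵇ x x refl , ≺⇒lexLt u≺v)))

_≤ₗₑₓ_ : Rel (List ℕ × ℕ) 0ℓ
_≤ₗₑₓ_ = ×-Lex _≋_ _≺_ _≤_

≤ₗₑₓ-trans : Transitive _≤ₗₑₓ_
≤ₗₑₓ-trans = ×-transitive {_≈₁_ = _≋_} {_<₂_ = _≤_} ≋-isEquivalence <-resp-≈ ≺-trans ≤-trans

≤ₗₑₓ-antisym : Antisymmetric (×-Pointwise _≋_ _≡_) _≤ₗₑₓ_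
≤ₗₑₓ-antisym = ×-antisymmetric {_≈₁_ = _≋_} {_<₂_ = _≤_} ≋.sym ≺-irrefl ≺-asym ≤-antisym

≤ₗₑₓ-total : Total _≤ₗₑₓ_
≤ₗₑₓ-total = ×-total₂ {_≈₁_ = _≋_} {_<₂_ = _≤_} ≋.sym ≺-compare ≤-total

≤ₗₑₓ-∷⇔ : ∀ {x u v a b} → (x ∷ u , a) ≤ₗₑₓ (x ∷ v , b) ⇔ (u , a) ≤ₗₑₓ (v , b)
≤ₗₑₓ-∷⇔ = mk⇔ drop keep
  where
  drop : ∀ {x u v a b} → (x ∷ u , a) ≤ₗₑₓ (x ∷ v , b) → (u , a) ≤ₗₑₓ (v , b)
  drop (inj₁ (this x<x))      = contradiction x<x (<-irrefl refl)
  drop (inj₁ (next _ u≺v))    = inj₁ u≺v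
  drop (inj₂ (_ ∷ u≋v , a≤b)) = inj₂ (u≋v , a≤b)
  keep : ∀ {x u v a b} → (u , a) ≤ₗₑₓ (v , b) → (x ∷ u , a) ≤ₗₑₓ (x ∷ v , b)
  keep (inj₁ u≺v)         = inj₁ (next refl u≺v)
  keep (inj₂ (u≋v , a≤b)) = inj₂ (refl ∷ u≋v , a≤b)

≤ₗₑₓ-∷⇒≤ : ∀ {x y u v a b} → (x ∷ u , a) ≤ₗₑₓ (y ∷ v , b) → x ≤ y
≤ₗₑₓ-∷⇒≤ (inj₁ (this x<y))     = <⇒≤ x<y
≤ₗₑₓ-∷⇒≤ (inj₁ (next refl _))  = ≤-refl
≤ₗₑₓ-∷⇒≤ (inj₂ (refl ∷ _ , _)) = ≤-refl

tieBreak⇔≤ₗₑₓ : ∀ u v a b →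
  T (lexLt u v ∨ (not (lexLt u v) ∧ not (lexLt v u) ∧ (a ≤ᵇ b))) ⇔ (u , a) ≤ₗₑₓ (v , b)
tieBreak⇔≤ₗₑₓ u v a b = mk⇔ ⇒ ⇐
  where
  ⇒ : T (lexLt u v ∨ (not (lexLt u v) ∧ not (lexLt v u) ∧ (a ≤ᵇ b))) → (u , a) ≤ₗₑₓ (v , b)
  ⇒ t with to T-∨ t
  ... | inj₁ u<v = inj₁ (lexLt⇒≺ u v u<v)
  ... | inj₂ t′ with u≮v , t″ ← to T-∧ t′ with v≮u , a≤b ← to T-∧ t″ with ≺-compare u v
  ...   | tri< u≺v _ _ = contradiction (≺⇒lexLt u≺v) (T-not⇒¬T u≮v)
  ...   | tri≈ _ u≋v _ = inj₂ (u≋v , ≤ᵇ⇒≤ a b a≤b)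
  ...   | tri> _ _ v≺u = contradiction (≺⇒lexLt v≺u) (T-not⇒¬T v≮u)
  ⇐ : (u , a) ≤ₗₑₓ (v , b) → T (lexLt u v ∨ (not (lexLt u v) ∧ not (lexLt v u) ∧ (a ≤ᵇ b)))
  ⇐ (inj₁ u≺v)         = from T-∨ (inj₁ (≺⇒lexLt u≺v))
  ⇐ (inj₂ (u≋v , a≤b)) = from T-∨ (inj₂ (from T-∧ (¬T⇒T-not (≺-irrefl u≋v ∘ lexLt⇒≺ u v) ,
                           from T-∧ (¬T⇒T-not (≺-irrefl (≋.sym u≋v) ∘ lexLt⇒≺ v u) , ≤⇒≤ᵇ a≤b))))

key : Haps → ℕ → ℕ → List ℕ
key S j a = reverse (prefixStr S a j)

rank : Haps → ℕ → ℕ → List ℕ × ℕ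
rank S j a = key S j a , a

precedes⇔≤ₗₑₓ : ∀ S j a b → T (precedes S j a b) ⇔ rank S j a ≤ₗₑₓ rank S j b
precedes⇔≤ₗₑₓ S j a b = tieBreak⇔≤ₗₑₓ (key S j a) (key S j b) a b

key-suc : ∀ S k a → key S (suc (suc k)) a ≡ S a (suc k) ∷ key S (suc k) a
key-suc S k a = begin
  reverse (map (S a) (applyUpTo suc (suc k)))
    ≡⟨ cong (reverse ∘ map (S a)) (applyUpTo-∷ʳ suc k) ⟨
  reverse (map (S a) (applyUpTo suc k ++ suc k ∷ []))
    ≡⟨ cong reverse (map-++ (S a) (applyUpTo suc k) _) ⟩
  reverse (map (S a) (applyUpTo suc k) ++ S a (suc k) ∷ [])
    ≡⟨ reverse-++ (map (S a) (applyUpTo suc k)) _ ⟩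
  S a (suc k) ∷ key S (suc k) a
    ∎
  where open ≡-Reasoning

precedes-suc⇔ : ∀ S k {a b} → S a (suc k) ≡ S b (suc k) →
  T (precedes S (suc (suc k)) a b) ⇔ T (precedes S (suc k) a b)
precedes-suc⇔ S k {a} {b} same =
  ⇔-sym (precedes⇔≤ₗₑₓ S (suc k) a b) ⇔-∘ (≤ₗₑₓ-∷⇔ ⇔-∘ (ranks ⇔-∘ precedes⇔≤ₗₑₓ S (suc (suc k)) a b))
  where
  ranks : rank S (suc (suc k)) a ≤ₗₑₓ rank S (suc (suc k)) b ⇔
          (S b (suc k) ∷ key S (suc k) a , a) ≤ₗₑₓ (S b (suc k) ∷ key S (suc k) b , b)
  ranks rewrite key-suc S k a | key-suc S k b | same = ⇔-id _

precedes-suc⇒≤ : ∀ S k {a b} → T (precedes S (suc (suc k)) a b) → S a (suc k) ≤ S b (suc k)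
precedes-suc⇒≤ S k {a} {b} a⊑b with to (precedes⇔≤ₗₑₓ S (suc (suc k)) a b) a⊑b
... | a≤b rewrite key-suc S k a | key-suc S k b = ≤ₗₑₓ-∷⇒≤ a≤b

precedes-decTotalOrder : Haps → ℕ → DecTotalOrder 0ℓ 0ℓ 0ℓ
precedes-decTotalOrder S j = record
  { Carrier         = ℕ
  ; _≈_             = _≡_
  ; _≤_             = λ a b → T (precedes S j a b)
  ; isDecTotalOrder = record
    { isTotalOrder = record
      { isPartialOrder = record
        { isPreorder = record
          { isEquivalence = ≡.isEquivalence
          ; reflexive     = λ { refl → from ⇔ₗₑₓ (inj₂ (≋.refl , ≤-refl)) }
          ; trans         = λ p q → from ⇔ₗₑₓ (≤ₗₑₓ-trans (to ⇔ₗₑₓ p) (to ⇔ₗₑₓ q))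
          }
        ; antisym = λ p q → proj₂ (≤ₗₑₓ-antisym (to ⇔ₗₑₓ p) (to ⇔ₗₑₓ q))
        }
      ; total = λ a b → Sum.map (from ⇔ₗₑₓ) (from ⇔ₗₑₓ) (≤ₗₑₓ-total (rank S j a) (rank S j b))
      }
    ; _≟_  = _≟_
    ; _≤?_ = λ a b → T? (precedes S j a b)
    }
  }
  where
  ⇔ₗₑₓ : ∀ {a b} → T (precedes S j a b) ⇔ rank S j a ≤ₗₑₓ rank S j b
  ⇔ₗₑₓ = precedes⇔≤ₗₑₓ S j _ _

StrictlyPrecedes : Haps → ℕ → Rel ℕ 0ℓ
StrictlyPrecedes S j a b = T (precedes S j a b) × a ≢ b

StrictlyPrecedes-asym : ∀ S j → Asymmetric (StrictlyPrecedes S j)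
StrictlyPrecedes-asym S j (a⊑b , a≢b) (b⊑a , _) = a≢b (antisym a⊑b b⊑a)
  where open DecTotalOrder (precedes-decTotalOrder S j) using (antisym)

module _ (S : Haps) (j : ℕ) where
  open InsertionSort (precedes-decTotalOrder S j) using (insert; sort)
  open InsertionSortₚ (precedes-decTotalOrder S j) using (sort-↭; sort-↗)

  insertBy≡insert : ∀ x ys → insertBy (precedes S j) x ys ≡ insert x ys
  insertBy≡insert x []       = refl
  insertBy≡insert x (y ∷ ys) with precedes S j x y
  ... | true  = refl
  ... | false = cong (y ∷_) (insertBy≡insert x ys)

  sortBy≡sort : ∀ xs → sortBy (precedes S j) xs ≡ sort xs
  sortBy≡sort []       = refl
  sortBy≡sort (x ∷ xs) rewrite sortBy≡sort xs = insertBy≡insert x (sort xs)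

  colPA-↭ : ∀ h → colPA S h j ↭ upTo1 h
  colPA-↭ h rewrite sortBy≡sort (upTo1 h) = sort-↭ (upTo1 h)

  colPA-sorted : ∀ h → AllPairs (λ a b → T (precedes S j a b)) (colPA S h j)
  colPA-sorted h rewrite sortBy≡sort (upTo1 h) =
    Sorted⇒AllPairs (DecTotalOrder.totalOrder (precedes-decTotalOrder S j)) (sort-↗ (upTo1 h))

  colPA-unique : ∀ h → Unique (colPA S h j)
  colPA-unique h = Permutationₛ.Unique-resp-↭ (≡.setoid ℕ) (↭⇒↭ₛ (↭-sym (colPA-↭ h)))
    (Unique.applyUpTo⁺₁ suc h (λ i<j _ → <⇒≢ (s<s i<j)))

  colPA-strictlySorted : ∀ h → AllPairs (StrictlyPrecedes S j) (colPA S h j)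
  colPA-strictlySorted h = AllPairs.zip (colPA-sorted h , colPA-unique h)

  length-colPA : ∀ h → length (colPA S h j) ≡ h
  length-colPA h = trans (↭-length (colPA-↭ h)) (length-applyUpTo suc h)

∈-colPA : ∀ S h j j′ {c} → c ∈ colPA S h j → c ∈ colPA S h j′
∈-colPA S h j j′ = ∈-resp-↭ (↭-trans (colPA-↭ S j h) (↭-sym (colPA-↭ S j′ h)))

-- The top row (r = 0) is covered by the junk value at xs 0 = 0.
φ-at : ∀ S h j {r} → r < h → φ S h j (at (colPA S h j) (suc r)) ≡ at (colPA S h j) r
φ-at S h j {r} r<h
  rewrite posOf-at (colPA-unique S j h) (subst (r <_) (sym (length-colPA S j h)) r<h) with r
... | zero  = sym (at-zero (colPA S h j))
... | suc _ = refl

Adjacent-suc : ∀ S h k {w c} → Adjacent (colPA S h (suc k)) w c → S w (suc k) ≡ S c (suc k) →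
  Adjacent (colPA S h (suc (suc k))) w c
Adjacent-suc S h k {w} {c} adjacent same =
  nothing-between⇒Adjacent (StrictlyPrecedes-asym S (suc (suc k))) (colPA-strictlySorted S (suc (suc k)) h)
    (∈-colPA S h (suc k) (suc (suc k)) (Adjacent⇒∈ˡ adjacent))
    (∈-colPA S h (suc k) (suc (suc k)) (Adjacent⇒∈ʳ adjacent))
    (lift same (Adjacent⇒⊏ (StrictlyPrecedes-asym S (suc k)) (colPA-strictlySorted S (suc k) h) adjacent))
    between
  where
  lift : ∀ {a b} → S a (suc k) ≡ S b (suc k) →
    StrictlyPrecedes S (suc k) a b → StrictlyPrecedes S (suc (suc k)) a b
  lift same (a⊑b , a≢b) = from (precedes-suc⇔ S k same) a⊑b , a≢b
  -- A row between w and c in column k + 2 shares their character, so it was already between them.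
  between : ∀ {z} → z ∈ colPA S h (suc (suc k)) →
    StrictlyPrecedes S (suc (suc k)) w z → StrictlyPrecedes S (suc (suc k)) z c → ⊥
  between {z} z∈ (w⊑z , w≢z) (z⊑c , z≢c) =
    Adjacent⇒nothing-between (StrictlyPrecedes-asym S (suc k)) (colPA-strictlySorted S (suc k) h) adjacent
      (∈-colPA S h (suc (suc k)) (suc k) z∈)
      (to (precedes-suc⇔ S k (trans same (sym z≡c))) w⊑z , w≢z)
      (to (precedes-suc⇔ S k z≡c) z⊑c , z≢c)
    where
    z≡c : S z (suc k) ≡ S c (suc k)
    z≡c = ≤-antisym (precedes-suc⇒≤ S k z⊑c) (subst (_≤ S z (suc k)) same (precedes-suc⇒≤ S k w⊑z))

¬isBreak⇒¬isRunTop : ∀ S h m k {q} → q < h →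
  ¬ T (isBreak S h m (at (colPA S h k) (suc q)) k) → ¬ T (isRunTop S h (suc q) k)
¬isBreak⇒¬isRunTop S h m k {q} q<h ¬break top = ¬break (from T-∨ (inj₂ (any⁺ _
  (lose (∈-applyUpTo⁺ suc q<h) (from T-∧ (top , ≡⇒≡ᵇ (at (colPA S h k) (suc q)) _ refl))))))

¬isRunTop⇒sameAsAbove : ∀ S h k q → ¬ T (isRunTop S h (suc q) k) →
  ∃[ r ] q ≡ suc r × pbwt S h k (suc q) ≡ pbwt S h k (suc r)
¬isRunTop⇒sameAsAbove S h k zero    ¬top = contradiction _ ¬top
¬isRunTop⇒sameAsAbove S h k (suc r) ¬top = r , refl , ≡ᵇ⇒≡ _ _ (¬T-not⇒T ¬top)

-- Refined segments

overlapCount-extendʳ : ∀ {b e e′} R → e ≤ e′ → All (λ J → proj₂ J ≤ e) R →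
  overlapCount (b , e′) R ≡ overlapCount (b , e) R
overlapCount-extendʳ []            _    []            = refl
overlapCount-extendʳ {b} ((a , f) ∷ R) e≤e′ (f≤e ∷ f≤es)
  rewrite m≥n⇒m⊓n≡n (≤-trans f≤e e≤e′) | m≥n⇒m⊓n≡n f≤e with (b ⊔ a) ≤ᵇ f
... | true  = cong suc (overlapCount-extendʳ {b} R e≤e′ f≤es)
... | false = overlapCount-extendʳ {b} R e≤e′ f≤es

overlapCount-≡0 : ∀ {b e} R → All (λ J → proj₂ J < b) R → overlapCount (b , e) R ≡ 0
overlapCount-≡0 {b} {e} R ends<b =
  cong length (filter-none (λ J → T? (overlaps (b , e) J)) (All.map disjoint ends<b))
  where
  disjoint : ∀ {J} → proj₂ J < b → ¬ T (overlaps (b , e) J)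
  disjoint {a , f} f<b meets = <⇒≱ (≤-<-trans (m⊓n≤n e f) f<b) (≤-trans (m≤m⊔n b a) (≤ᵇ⇒≤ _ _ meets))

update-All : ∀ {A : Set} {P : A → Set} f c v → (∀ c″ → P (f c″)) → P v → ∀ c″ → P (update f c v c″)
update-All f c v Pf Pv c″ with c″ ≡ᵇ c
... | true  = Pv
... | false = Pf c″

split : State → ℕ → List Interval → Interval → State
split s c rest seg = st (update (L s) c rest) (update (RS s) c (RS s c ++ seg ∷ []))

-- The decomposition algorithm

module Decomposition (S : Haps) (h m d : ℕ) where

  PA : ℕ → List ℕ
  PA = colPA S h

  stepAt : ℕ → ℕ → State → State
  stepAt = step S h m d

  rowsUpTo : ℕ → ℕ → State → State
  rowsUpTo = runRows S h m d

  <-length : ∀ j {r} → r < h → r < length (PA j)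
  <-length j {r} = subst (r <_) (sym (length-colPA S j h))

  data StepCase (j i : ℕ) (s : State) : Set where
    exhausted : L s (at (PA j) i) ≡ [] → stepAt j i s ≡ s → StepCase j i s
    passive   : ∀ {b rest} → L s (at (PA j) i) ≡ (b , j) ∷ rest →
                stepAt j i s ≡ split s (at (PA j) i) rest (b , j) → StepCase j i s
    active    : ∀ {b e rest} → L s (at (PA j) i) ≡ (b , e) ∷ rest → j ≢ e →
                stepAt j i s ≡ split s (at (PA j) i) ((suc j , e) ∷ rest) (b , j) → StepCase j i s
    unsplit   : ∀ {b e rest} → L s (at (PA j) i) ≡ (b , e) ∷ rest → j ≢ e →
                ¬ (1 < i × overlapCount (b , j) (RS s (at (PA j) (i ∸ 1))) ≡ d) →
                stepAt j i s ≡ s → StepCase j i s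

  private
    splitCondition : ℕ → ℕ → State → ℕ → Bool
    splitCondition j i s b = (1 <ᵇ i) ∧ (overlapCount (b , j) (RS s (at (PA j) (i ∸ 1))) ≡ᵇ d)

    step-exhausted : ∀ {j i s} → L s (at (PA j) i) ≡ [] → stepAt j i s ≡ s
    step-exhausted head rewrite head = refl

    step-passive : ∀ {j i s b rest} → L s (at (PA j) i) ≡ (b , j) ∷ rest →
      stepAt j i s ≡ split s (at (PA j) i) rest (b , j)
    step-passive {j} head rewrite head | ≡ᵇ-refl j = refl

    step-active : ∀ {j i s b e rest} → L s (at (PA j) i) ≡ (b , e) ∷ rest → (j ≡ᵇ e) ≡ false →
      splitCondition j i s b ≡ true → stepAt j i s ≡ split s (at (PA j) i) ((suc j , e) ∷ rest) (b , j)
    step-active head j≟e split? rewrite head | j≟e | split? = refl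

    step-unsplit : ∀ {j i s b e rest} → L s (at (PA j) i) ≡ (b , e) ∷ rest → (j ≡ᵇ e) ≡ false →
      splitCondition j i s b ≡ false → stepAt j i s ≡ s
    step-unsplit head j≟e split? rewrite head | j≟e | split? = refl

  stepCase : ∀ j i s → StepCase j i s
  stepCase j i s with L s (at (PA j) i) in head
  ... | [] = exhausted head (step-exhausted head)
  ... | (b , e) ∷ rest with j ≡ᵇ e in j≟e
  ...   | true with refl ← ≡ᵇ⇒≡ j e (from T-≡ j≟e) = passive head (step-passive head)
  ...   | false with splitCondition j i s b in split?
  ...     | true  = active head (≡ᵇ-false⇒≢ j≟e) (step-active head j≟e split?)
  ...     | false = unsplit head (≡ᵇ-false⇒≢ j≟e) refused (step-unsplit head j≟e split?)
    where
    refused : ¬ (1 < i × overlapCount (b , j) (RS s (at (PA j) (i ∸ 1))) ≡ d)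
    refused (1<i , count≡d) = ≡false⇒¬T split? (from T-∧ (<⇒<ᵇ 1<i , ≡⇒≡ᵇ _ d count≡d))

  step-idle⊎split : ∀ j i s →
    stepAt j i s ≡ s ⊎ ∃₂ λ rest b → stepAt j i s ≡ split s (at (PA j) i) rest (b , j)
  step-idle⊎split j i s with stepCase j i s
  ... | exhausted _ eq   = inj₁ eq
  ... | unsplit _ _ _ eq = inj₁ eq
  ... | passive _ eq     = inj₂ (_ , _ , eq)
  ... | active _ _ eq    = inj₂ (_ , _ , eq)

  lists : State → ℕ → List Interval × List Interval
  lists s c = L s c , RS s c

  -- stateBefore S h m d j i unfolds to rowsUpTo j (i ∸ 1) (afterColumns (j ∸ 1)).
  afterColumns : ℕ → State
  afterColumns k = runCols S h m d k (initState S h m)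

  rowsUpTo-suc : ∀ j r s → rowsUpTo j (suc r) s ≡ stepAt j (suc r) (rowsUpTo j r s)
  rowsUpTo-suc j r s = begin
    foldl (λ t i → stepAt j i t) s (applyUpTo suc (suc r))
      ≡⟨ cong (foldl _ s) (applyUpTo-∷ʳ suc r) ⟨
    foldl (λ t i → stepAt j i t) s (applyUpTo suc r ++ suc r ∷ [])
      ≡⟨ foldl-∷ʳ _ s (suc r) (applyUpTo suc r) ⟩
    stepAt j (suc r) (rowsUpTo j r s)
      ∎
    where open ≡-Reasoning

  afterColumns-suc : ∀ k → afterColumns (suc k) ≡ rowsUpTo (suc k) h (afterColumns k)
  afterColumns-suc k = begin
    foldl (λ t j → rowsUpTo j h t) s₀ (applyUpTo suc (suc k))
      ≡⟨ cong (foldl _ s₀) (applyUpTo-∷ʳ suc k) ⟨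
    foldl (λ t j → rowsUpTo j h t) s₀ (applyUpTo suc k ++ suc k ∷ [])
      ≡⟨ foldl-∷ʳ _ s₀ (suc k) (applyUpTo suc k) ⟩
    rowsUpTo (suc k) h (afterColumns k)
      ∎
    where
    open ≡-Reasoning
    s₀ : State
    s₀ = initState S h m

  split-same : ∀ s c rest seg → lists (split s c rest seg) c ≡ (rest , RS s c ++ seg ∷ [])
  split-same s c rest seg rewrite ≡ᵇ-refl c = refl

  split-other : ∀ s {c c″} rest seg → c″ ≢ c → lists (split s c rest seg) c″ ≡ lists s c″
  split-other s rest seg c″≢c rewrite ≢⇒≡ᵇ-false c″≢c = refl

  private
    L-step : ∀ j i s {t} → stepAt j i s ≡ t → L (stepAt j i s) (at (PA j) i) ≡ L t (at (PA j) i)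
    L-step j i s eq = cong (λ t → L t (at (PA j) i)) eq

    L-step-split : ∀ j i s {rest seg} → stepAt j i s ≡ split s (at (PA j) i) rest seg →
      L (stepAt j i s) (at (PA j) i) ≡ rest
    L-step-split j i s {rest} {seg} eq = trans (L-step j i s eq) (cong proj₁ (split-same s _ rest seg))

    RS-step : ∀ j i s {t} → stepAt j i s ≡ t → RS (stepAt j i s) (at (PA j) i) ≡ RS t (at (PA j) i)
    RS-step j i s eq = cong (λ t → RS t (at (PA j) i)) eq

    RS-step-split : ∀ j i s {rest seg} → stepAt j i s ≡ split s (at (PA j) i) rest seg →
      RS (stepAt j i s) (at (PA j) i) ≡ RS s (at (PA j) i) ++ seg ∷ []
    RS-step-split j i s {rest} {seg} eq = trans (RS-step j i s eq) (cong proj₂ (split-same s _ rest seg))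

  step-other : ∀ j i s {c} → c ≢ at (PA j) i → lists (stepAt j i s) c ≡ lists s c
  step-other j i s {c} c≢ with step-idle⊎split j i s
  ... | inj₁ idle           = cong (λ t → lists t c) idle
  ... | inj₂ (_ , _ , eq) = trans (cong (λ t → lists t c) eq) (split-other s _ _ c≢)

  lists-rowsUpTo : ∀ {j c s} r n → r ≤ n → (∀ {r′} → r < r′ → r′ ≤ n → c ≢ at (PA j) r′) →
    lists (rowsUpTo j n s) c ≡ lists (rowsUpTo j r s) c
  lists-rowsUpTo r zero    z≤n    _ = refl
  lists-rowsUpTo {j} {c} {s} r (suc n) r≤1+n untouched with m≤n⇒m<n∨m≡n r≤1+n
  ... | inj₂ refl  = refl
  ... | inj₁ r<1+n = begin
    lists (rowsUpTo j (suc n) s) c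
      ≡⟨ cong (λ t → lists t c) (rowsUpTo-suc j n s) ⟩
    lists (stepAt j (suc n) (rowsUpTo j n s)) c
      ≡⟨ step-other j (suc n) (rowsUpTo j n s) (untouched r<1+n ≤-refl) ⟩
    lists (rowsUpTo j n s) c
      ≡⟨ lists-rowsUpTo r n (s≤s⁻¹ r<1+n) (λ r<r′ r′≤n → untouched r<r′ (m≤n⇒m≤1+n r′≤n)) ⟩
    lists (rowsUpTo j r s) c
      ∎
    where open ≡-Reasoning

  at-PA-∈ : ∀ j j′ {r} → r < h → at (PA j) (suc r) ∈ PA j′
  at-PA-∈ j j′ r<h = ∈-colPA S h j j′ (at-∈ (PA j) (<-length j r<h))

  rows-differ : ∀ j {q r} → q < h → r < h → q ≢ r → at (PA j) (suc q) ≢ at (PA j) (suc r)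
  rows-differ j q<h r<h q≢r = q≢r ∘ at-injective (colPA-unique S j h) (<-length j q<h) (<-length j r<h)

  lists-before-row : ∀ j {q} s r → q < h → r ≤ q →
    lists (rowsUpTo j r s) (at (PA j) (suc q)) ≡ lists s (at (PA j) (suc q))
  lists-before-row j s r q<h r≤q = lists-rowsUpTo 0 r z≤n λ { {suc r′} _ r′<r →
    rows-differ j q<h (<-≤-trans r′<r (≤-trans r≤q (<⇒≤ q<h))) (>⇒≢ (<-≤-trans r′<r r≤q)) }

  lists-after-row : ∀ j {q} s n → q < h → suc q ≤ n → n ≤ h →
    lists (rowsUpTo j n s) (at (PA j) (suc q)) ≡ lists (rowsUpTo j (suc q) s) (at (PA j) (suc q))
  lists-after-row j s n q<h q<n n≤h = lists-rowsUpTo _ n q<n λ { {suc r′} q<r′ r′<n →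
    rows-differ j q<h (<-≤-trans r′<n n≤h) (<⇒≢ (s≤s⁻¹ q<r′)) }

  lists-afterColumn : ∀ k {q} → q < h →
    lists (afterColumns (suc k)) (at (PA (suc k)) (suc q))
      ≡ lists (rowsUpTo (suc k) (suc q) (afterColumns k)) (at (PA (suc k)) (suc q))
  lists-afterColumn k q<h =
    trans (cong (λ t → lists t _) (afterColumns-suc k))
          (lists-after-row (suc k) (afterColumns k) h q<h q<h ≤-refl)

  L-afterColumn : ∀ k {q} → q < h →
    L (afterColumns (suc k)) (at (PA (suc k)) (suc q))
      ≡ L (stepAt (suc k) (suc q) (rowsUpTo (suc k) q (afterColumns k))) (at (PA (suc k)) (suc q))
  L-afterColumn k {q} q<h =
    trans (cong proj₁ (lists-afterColumn k q<h))
          (cong (λ t → L t _) (rowsUpTo-suc (suc k) q (afterColumns k)))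

  ∈-PA⇒row : ∀ j {c} → c ∈ PA j → ∃[ q ] q < h × at (PA j) (suc q) ≡ c
  ∈-PA⇒row j c∈ with q , q<n , c-row ← ∈⇒at c∈ = q , subst (q <_) (length-colPA S j h) q<n , c-row

  EndsBy : ℕ → State → Set
  EndsBy k s = ∀ c → All (λ seg → proj₂ seg ≤ k) (RS s c)

  step-EndsBy : ∀ j i s → EndsBy j s → EndsBy j (stepAt j i s)
  step-EndsBy j i s ends with step-idle⊎split j i s
  ... | inj₁ idle = subst (EndsBy j) (sym idle) ends
  ... | inj₂ (_ , _ , eq) = subst (EndsBy j) (sym eq)
    (update-All {P = All (λ seg → proj₂ seg ≤ j)} (RS s) _ _ ends (All.++⁺ (ends _) (≤-refl ∷ [])))

  rowsUpTo-EndsBy : ∀ j n s → EndsBy j s → EndsBy j (rowsUpTo j n s)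
  rowsUpTo-EndsBy j zero    s ends = ends
  rowsUpTo-EndsBy j (suc n) s ends rewrite rowsUpTo-suc j n s =
    step-EndsBy j (suc n) (rowsUpTo j n s) (rowsUpTo-EndsBy j n s ends)

  afterColumns-EndsBy : ∀ k → EndsBy k (afterColumns k)
  afterColumns-EndsBy zero    c = []
  afterColumns-EndsBy (suc k) rewrite afterColumns-suc k =
    rowsUpTo-EndsBy (suc k) h (afterColumns k) (All.map m≤n⇒m≤1+n ∘ afterColumns-EndsBy k)

  -- What remains of L_c when c's row of column k is reached.
  record Pending (c k : ℕ) (intervals : List Interval) : Set where
    constructor pending
    field
      start       : ℕ
      ends        : List ℕ
      shape       : intervals ≡ mkIntervals start ends
      start≤k     : start ≤ k
      k≤ends      : All (k ≤_) ends
      increasing  : AllPairs _<_ ends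
      breaks⊆ends : ∀ {x} → start ≤ x → x ≤ m → T (isBreak S h m c x) → x ∈ ends

  Pending-init : ∀ c → Pending c 1 (hapIntervals S h m c)
  Pending-init c = record
    { start       = 1
    ; ends        = breaks S h m c
    ; shape       = refl
    ; start≤k     = ≤-refl
    ; k≤ends      = All.filter⁺ _ (All.applyUpTo⁺₁ suc m (λ _ → s≤s z≤n))
    ; increasing  = AllPairs.filter⁺ _ (AllPairs.applyUpTo⁺₁ suc m (λ i<j _ → s<s i<j))
    ; breaks⊆ends = λ { {suc x} _ x<m break → ∈-filter⁺ _ (∈-applyUpTo⁺ suc x<m) break }
    }

  private
    pastColumn : ∀ {k e es} → k ≤ e → k ≢ e → All (e <_) es → All (suc k ≤_) (e ∷ es)
    pastColumn {k} {e} k≤e k≢e e<es = k<e ∷ All.map (<-trans k<e) e<es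
      where
      k<e : k < e
      k<e = ≤∧≢⇒< k≤e k≢e

  step-Pending : ∀ k i s → Pending (at (PA k) i) k (L s (at (PA k) i)) →
    Pending (at (PA k) i) (suc k) (L (stepAt k i s) (at (PA k) i))
  step-Pending k i s (pending start [] shape start≤k _ increasing breaks⊆ends) with stepCase k i s
  ... | exhausted _ eq = subst (Pending (at (PA k) i) (suc k)) (sym (L-step k i s eq))
                           (pending start [] shape (m≤n⇒m≤1+n start≤k) [] increasing breaks⊆ends)
  ... | unsplit head _ _ _ with () ← trans (sym head) shape
  ... | active head _ _    with () ← trans (sym head) shape
  ... | passive head _     with () ← trans (sym head) shape
  step-Pending k i s (pending start (e ∷ es) shape start≤k k≤ends increasing breaks⊆ends) with stepCase k i s
  ... | exhausted head _ with () ← trans (sym head) shape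
  ... | unsplit head k≢e _ eq with refl ← trans (sym head) shape =
    subst (Pending (at (PA k) i) (suc k)) (sym (L-step k i s eq))
      (pending start (e ∷ es) shape (m≤n⇒m≤1+n start≤k)
        (pastColumn (All.head k≤ends) k≢e (AllPairs.head increasing)) increasing breaks⊆ends)
  ... | active head k≢e eq with refl ← trans (sym head) shape =
    subst (Pending (at (PA k) i) (suc k)) (sym (L-step-split k i s eq))
      (pending (suc k) (e ∷ es) refl ≤-refl
        (pastColumn (All.head k≤ends) k≢e (AllPairs.head increasing)) increasing
        (breaks⊆ends ∘ ≤-trans (m≤n⇒m≤1+n start≤k)))
  ... | passive head eq with refl ← trans (sym head) shape =
    subst (Pending (at (PA k) i) (suc k)) (sym (L-step-split k i s eq))
      (pending (suc k) es refl ≤-refl (AllPairs.head increasing) (AllPairs.tail increasing) breaks⊆es)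
    where
    breaks⊆es : ∀ {x} → suc k ≤ x → x ≤ m → T (isBreak S h m (at (PA k) i) x) → x ∈ es
    breaks⊆es k<x x≤m break with breaks⊆ends (≤-trans start≤k (<⇒≤ k<x)) x≤m break
    ... | here refl  = contradiction k<x (<-irrefl refl)
    ... | there x∈es = x∈es

  Pending-afterColumns : ∀ {c} j → c ∈ PA j → ∀ k → Pending c (suc k) (L (afterColumns k) c)
  Pending-afterColumns j c∈ zero    = Pending-init _
  Pending-afterColumns j c∈ (suc k) with q , q<h , refl ← ∈-PA⇒row (suc k) (∈-colPA S h j (suc k) c∈) =
    subst (Pending _ (suc (suc k))) (sym (L-afterColumn k q<h))
      (step-Pending (suc k) (suc q) (rowsUpTo (suc k) q (afterColumns k))
        (subst (Pending _ (suc k)) (sym (cong proj₁ (lists-before-row (suc k) (afterColumns k) q q<h ≤-refl)))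
          (Pending-afterColumns j c∈ k)))

  Pending-atRow : ∀ k {q} → q < h →
    let c = at (PA (suc k)) (suc q) in Pending c (suc k) (L (rowsUpTo (suc k) q (afterColumns k)) c)
  Pending-atRow k {q} q<h =
    subst (Pending _ (suc k)) (sym (cong proj₁ (lists-before-row (suc k) (afterColumns k) q q<h ≤-refl)))
      (Pending-afterColumns (suc k) (at-PA-∈ (suc k) (suc k) q<h) k)

  surviving-head⇒unsplit : ∀ k i s {b e rest} → k ≤ m →
    Pending (at (PA k) i) k (L s (at (PA k) i)) →
    L (stepAt k i s) (at (PA k) i) ≡ (b , e) ∷ rest → b ≤ k →
    ¬ T (isBreak S h m (at (PA k) i) k) × ¬ (1 < i × overlapCount (b , k) (RS s (at (PA k) (i ∸ 1))) ≡ d)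
  surviving-head⇒unsplit k i s k≤m (pending start [] shape _ _ _ _) survived b≤k with stepCase k i s
  ... | exhausted head eq  with () ← trans (sym survived) (trans (L-step k i s eq) head)
  ... | unsplit head _ _ _ with () ← trans (sym head) shape
  ... | active head _ _    with () ← trans (sym head) shape
  ... | passive head _     with () ← trans (sym head) shape
  surviving-head⇒unsplit k i s k≤m
    (pending start (e ∷ es) shape start≤k k≤ends increasing breaks⊆ends) survived b≤k with stepCase k i s
  ... | exhausted head _ with () ← trans (sym head) shape
  ... | active head _ eq with refl ← trans (sym head) shape
    with refl ← trans (sym survived) (L-step-split k i s eq) = contradiction b≤k (<-irrefl refl)
  ... | passive head eq with refl ← trans (sym head) shape
    with es | trans (sym survived) (L-step-split k i s eq)
  ...   | _ ∷ _ | refl = contradiction b≤k (<-irrefl refl)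
  surviving-head⇒unsplit k i s k≤m
    (pending start (e ∷ es) shape start≤k k≤ends increasing breaks⊆ends) survived b≤k
    | unsplit head k≢e refused eq with refl ← trans (sym head) shape
    with refl ← trans (sym survived) (trans (L-step k i s eq) head) = no-break , refused
    where
    no-break : ¬ T (isBreak S h m (at (PA k) i) k)
    no-break break with breaks⊆ends start≤k k≤m break
    ... | here k≡e   = k≢e k≡e
    ... | there k∈es = <⇒≱ (All.lookup (AllPairs.head increasing) k∈es) (All.head k≤ends)

  appended⇒head : ∀ j i s {seg} → RS (stepAt j i s) (at (PA j) i) ≡ RS s (at (PA j) i) ++ seg ∷ [] →
    ∃₂ λ e rest → L s (at (PA j) i) ≡ (proj₁ seg , e) ∷ rest
  appended⇒head j i s appended with stepCase j i s
  ... | exhausted _ eq   = contradiction (trans (sym (RS-step j i s eq)) appended) (≢-∷ʳ _ _)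
  ... | unsplit _ _ _ eq = contradiction (trans (sym (RS-step j i s eq)) appended) (≢-∷ʳ _ _)
  ... | passive head eq
    with refl ← proj₂ (∷ʳ-injective _ _ (trans (sym (RS-step-split j i s eq)) appended)) = _ , _ , head
  ... | active head _ eq
    with refl ← proj₂ (∷ʳ-injective _ _ (trans (sym (RS-step-split j i s eq)) appended)) = _ , _ , head

  surviving-head⇒predecessor : ∀ k {c b e rest} → suc k ≤ m → c ∈ PA (suc k) →
    L (afterColumns (suc k)) c ≡ (b , e) ∷ rest → b ≤ suc k →
    ∃[ w ] Adjacent (PA (suc k)) w c × S w (suc k) ≡ S c (suc k)
           × overlapCount (b , suc k) (RS (afterColumns (suc k)) w) ≢ d
  surviving-head⇒predecessor k {b = b} k<m c∈ head b≤k with q , q<h , refl ← ∈-PA⇒row (suc k) c∈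
    with no-break , refused ← surviving-head⇒unsplit (suc k) (suc q) (rowsUpTo (suc k) q (afterColumns k)) k<m
                                (Pending-atRow k q<h) (trans (sym (L-afterColumn k q<h)) head) b≤k
    with r , refl , same ← ¬isRunTop⇒sameAsAbove S h (suc k) q (¬isBreak⇒¬isRunTop S h m (suc k) q<h no-break)
    = at (PA (suc k)) (suc r) , (r , <-length (suc k) q<h , refl , refl) , sym same ,
      λ count≡d → refused (s<s z<s , trans (cong (overlapCount (b , suc k)) (sym w-unchanged)) count≡d)
    where
    w-unchanged : RS (afterColumns (suc k)) (at (PA (suc k)) (suc r))
                    ≡ RS (rowsUpTo (suc k) (suc r) (afterColumns k)) (at (PA (suc k)) (suc r))
    w-unchanged = cong proj₂ (lists-afterColumn k (<-trans (n<1+n r) q<h))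

  idle-predecessor-impossible : ∀ k p {b e rest} → 0 < d → k ≤ m → suc p < h →
    let c = at (PA (suc k)) (suc (suc p)); c′ = at (PA (suc k)) (suc p) in
    L (afterColumns k) c ≡ (b , e) ∷ rest → overlapCount (b , suc k) (RS (afterColumns k) c′) ≡ d → ⊥
  idle-predecessor-impossible k p {b} d>0 k≤m p<h head count≡d with b ≤? k
  ... | no b≰k = <-irrefl (trans (sym (overlapCount-≡0 _ ends<b)) count≡d) d>0
    where
    ends<b : All (λ seg → proj₂ seg < b) (RS (afterColumns k) (at (PA (suc k)) (suc p)))
    ends<b = All.map (λ e≤k → ≤-<-trans e≤k (≰⇒> b≰k)) (afterColumns-EndsBy k _)
  idle-predecessor-impossible zero    p d>0 k≤m p<h head count≡d | yes _ = <-irrefl count≡d d>0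
  idle-predecessor-impossible (suc k) p {b} d>0 k≤m p<h head count≡d | yes b≤k
    with w , adjacent , same , count≢d
           ← surviving-head⇒predecessor k k≤m (at-PA-∈ (suc (suc k)) (suc k) p<h) head b≤k
    with refl ← Adjacent⇒above (colPA-unique S (suc (suc k)) h) (<-length (suc (suc k)) p<h)
                  (Adjacent-suc S h k adjacent same)
    = count≢d (trans (sym (overlapCount-extendʳ {b} _ (n≤1+n (suc k)) (afterColumns-EndsBy (suc k) w)))
                     count≡d)

  predecessor-ends-at-column : ∀ k p {b} → 0 < d → k ≤ m → suc p < h →
    let s = rowsUpTo (suc k) (suc p) (afterColumns k)
        c = at (PA (suc k)) (suc (suc p)); c′ = at (PA (suc k)) (suc p) in
    RS (stepAt (suc k) (suc (suc p)) s) c ≡ RS s c ++ (b , suc k) ∷ [] →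
    overlapCount (b , suc k) (RS s c′) ≡ d →
    ∃₂ λ pre a → RS s c′ ≡ pre ++ (a , suc k) ∷ []
  predecessor-ends-at-column k p {b} d>0 k≤m p<h appended count≡d
    with step-idle⊎split (suc k) (suc p) (rowsUpTo (suc k) p (afterColumns k))
  ... | inj₂ (_ , _ , split-eq) =
    _ , _ , trans (cong (λ t → RS t (at (PA (suc k)) (suc p))) (rowsUpTo-suc (suc k) p (afterColumns k)))
                  (RS-step-split (suc k) (suc p) _ split-eq)
  ... | inj₁ idle
    with _ , _ , head ← appended⇒head (suc k) (suc (suc p)) (rowsUpTo (suc k) (suc p) (afterColumns k))
                          appended =
    ⊥-elim $ idle-predecessor-impossible k p d>0 k≤m p<h
      (trans (sym (cong proj₁ (lists-before-row (suc k) (afterColumns k) (suc p) p<h ≤-refl))) head)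
      (trans (cong (overlapCount (b , suc k)) c′-unchanged) count≡d)
    where
    c′ = at (PA (suc k)) (suc p)
    unchanged : rowsUpTo (suc k) (suc p) (afterColumns k) ≡ rowsUpTo (suc k) p (afterColumns k)
    unchanged = trans (rowsUpTo-suc (suc k) p (afterColumns k)) idle
    c′-unchanged : RS (afterColumns k) c′ ≡ RS (rowsUpTo (suc k) (suc p) (afterColumns k)) c′
    c′-unchanged = sym (trans (cong (λ t → RS t c′) unchanged) (cong proj₂ c′-before-row))
      where
      c′-before-row : lists (rowsUpTo (suc k) p (afterColumns k)) c′ ≡ lists (afterColumns k) c′
      c′-before-row = lists-before-row (suc k) (afterColumns k) p (<-trans (n<1+n p) p<h) ≤-refl

lemma10 : (S : Haps) (h m d : ℕ) → 1 < d →
    (j i b : ℕ) → 1 ≤ j → j ≤ m → 1 ≤ i → i ≤ h →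
    -- while processing column j (row i, haplotype c = col_j(PA)[i]),
    -- the refined segment [b , j] is appended to the tail of RS[c]
    RS (step S h m d j i (stateBefore S h m d j i)) (at (colPA S h j) i)
      ≡ RS (stateBefore S h m d j i) (at (colPA S h j) i) ++ ((b , j) ∷ []) →
    -- c' = φ_j(c) ≥ 1
    1 ≤ φ S h j (at (colPA S h j) i) →
    -- at that moment [b , j] overlaps exactly d refined segments in RS[c']
    overlapCount (b , j) (RS (stateBefore S h m d j i) (φ S h j (at (colPA S h j) i))) ≡ d →
    -- the last refined segment in RS[c'] has right endpoint j
    ∃₂ λ (pre : List Interval) (a : ℕ) →
      RS (stateBefore S h m d j i) (φ S h j (at (colPA S h j) i)) ≡ pre ++ ((a , j) ∷ [])
lemma10 S h m d 1<d (suc k) (suc q) b _ k<m _ q<h appended φ≥1 count≡d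
  rewrite φ-at S h (suc k) q<h with q
... | zero  = contradiction (subst (1 ≤_) (at-zero (colPA S h (suc k))) φ≥1) λ ()
... | suc p = predecessor-ends-at-column k p (<⇒≤ 1<d) (<⇒≤ k<m) q<h appended count≡d
  where open Decomposition S h m d
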